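{- Let $G=(V,E)$ be the complete graph on $n$ vertices, and let $r\ge1$, $t\ge1$ be integers with $n\ge 2r+2t+2$. Let $p=t/\binom{n-2r}{2}$, let $\mathcal D_p$ be the distribution on $\{0,1\}^{V\cup E}$ obtained by setting each $x_i$, $i\in V$, to $1$ independently with probability $p$, and then setting $x_e=1$ for $e\in E$ iff $e$ has an endpoint $i$ with $x_i=1$. Define $y\in\mathbb R^{\mathcal P_{r+1}}$ by $y_A=\Pr_{\mathcal D_p}[x_q=1\ \forall q\in A]$ (so $y_\emptyset=1$). Then the vector $(y_A)_{A\in\mathcal P_1}$ belongs to the level-$r$ Sherali–Adams tightening $\mathcal S^{(r)}(P_t(G))$, with $y$ as witness.
   Context: $P_t(G)\subseteq[0,1]^m$, with ground set $[m]=V\cup E$, is the set of $x$ satisfying $x_i+x_j\ge x_e$ for every edge $e=\{i,j\}$, $\sum_{e\in E}x_e\ge t$, and $0\le x_q\le1$ for all $q$. Sherali–Adams: for $P\subseteq[0,1]^m$ given by constraints $a^Tx\ge b$, its homogenization $K$ is the cone of $\bar x\in\mathbb R^{\{\emptyset\}\cup[m]}$ with $\bar x_\emptyset\ge0$ and $a^T\bar x\ge b\bar x_\emptyset$. $\mathcal P_k$ = subsets of $[m]$ of size at most $k$. For $y\in\mathbb R^{\mathcal P_{r+1}}$ the moment matrix $\mathcal Y$ has rows indexed by $\mathcal P_1$, columns by $\mathcal P_r$, $\mathcal Y_{A,B}=y_{A\cup B}$; $\mathbf e_I$ are standard basis vectors. $M^{(r)}$ is the set of $x\in\mathbb R^{\mathcal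 P_1}$ for which there is $y\in\mathbb R^{\mathcal P_{r+1}}$ with $\mathcal Y\mathbf e_\emptyset=x$ and $\mathcal Y\sum_{T\subseteq N}(-1)^{|T|}\mathbf e_{Y\cup T}\in K$ for all $Y,N$ with $Y\cup N\in\mathcal P_r$; $\mathcal S^{(r)}(P)=M^{(r)}\cap\{x_\emptyset=1\}$. -}

module Defs where

open import Data.Bool using (Bool; true; false; _∧_; _∨_; if_then_else_)
open import Data.Nat as ℕ using (ℕ; zero; suc; _∸_; _≤_)
open import Data.Nat.Combinatorics using (_C_)
open import Data.Fin as Fin using (Fin; _<_; _<?_)
open import Data.Fin.Properties as FinP using (<-irrelevant)
open import Data.Vec as Vec using (Vec; []; _∷_; lookup)
open import Data.List as List using (List; []; _∷_; _++_; length; foldr; map; concatMap; mapMaybe; deduplicate)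
open import Data.List.Relation.Unary.All using (All)
open import Data.Maybe using (Maybe; just; nothing)
open import Data.Integer using (+_)
open import Data.Rational as ℚ using (ℚ; 0ℚ; 1ℚ; _+_; _*_; _-_; -_; _/_)
open import Data.Product using (_×_; _,_)
open import Relation.Binary.PropositionalEquality using (_≡_; refl; cong; cong₂)
open import Relation.Nullary using (Dec; yes; no; ¬_)
import Data.Fin as F

-- Ground set [m] = V ∪ E of the complete graph K_n on V = Fin n.
-- An edge {i,j} is represented once, as edg i j with i < j.

data Elem (n : ℕ) : Set where
  vtx : Fin n → Elem n
  edg : (i j : Fin n) → i < j → Elem n

_≟E_ : ∀ {n} (a b : Elem n) → Dec (a ≡ b)
vtx i ≟E vtx j with i F.≟ j
... | yes refl = yes refl
... | no ne = no λ { refl → ne refl }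
vtx _ ≟E edg _ _ _ = no λ ()
edg _ _ _ ≟E vtx _ = no λ ()
edg i j p ≟E edg k l q with i F.≟ k | j F.≟ l
... | yes refl | yes refl with <-irrelevant p q
...   | refl = yes refl
edg i j p ≟E edg k l q | no ne | _ = no λ { refl → ne refl }
edg i j p ≟E edg k l q | yes _ | no ne = no λ { refl → ne refl }

edges : (n : ℕ) → List (Elem n)
edges n = concatMap (λ i → mapMaybe (pick i) (List.allFin n)) (List.allFin n)
  where
  pick : Fin n → Fin n → Maybe (Elem n)
  pick i j with i <? j
  ... | yes p = just (edg i j p)
  ... | no _ = nothing

-- Finite subsets of the ground set are represented as lists (a set Y is a
-- duplicate-free list; the set Y ∪ N is deduplicate (Y ++ N)).
card∪ : ∀ {n} → List (Elem n) → List (Elem n) → ℕ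
card∪ Y N = length (deduplicate _≟E_ (Y ++ N))

-- all sub-lists (= all subsets, for a duplicate-free list)
subsets : ∀ {A : Set} → List A → List (List A)
subsets [] = [] ∷ []
subsets (x ∷ xs) = subsets xs ++ map (x ∷_) (subsets xs)

sumℚ : List ℚ → ℚ
sumℚ = foldr _+_ 0ℚ

signℚ : ℕ → ℚ
signℚ zero = 1ℚ
signℚ (suc k) = - signℚ k

xval : ∀ {n} → Vec Bool n → Elem n → Bool
xval S (vtx i) = lookup S i
xval S (edg i j _) = lookup S i ∨ lookup S j

allOne : ∀ {n} → Vec Bool n → List (Elem n) → Bool
allOne S A = foldr (λ q b → xval S q ∧ b) true A

Pr : (p : ℚ) (n : ℕ) → (Vec Bool n → Bool) → ℚ
Pr p zero f = if f [] then 1ℚ else 0ℚ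
Pr p (suc n) f = (p * Pr p n (λ S → f (true ∷ S)))
               + ((1ℚ - p) * Pr p n (λ S → f (false ∷ S)))

-- p = t / c, (c = binom(n-2r,2) is nonzero under the hypotheses)
divℚ : ℕ → ℕ → ℚ
divℚ t zero = 0ℚ
divℚ t (suc c) = (+ t) / suc c

pval : (n r t : ℕ) → ℚ
pval n r t = divℚ t ((n ∸ (2 ℕ.* r)) C 2)

yvec : (n r t : ℕ) → List (Elem n) → ℚ
yvec n r t A = Pr (pval n r t) n (λ S → allOne S A)

-- Homogenization K of P_t(K_n).  A point of R^{{∅} ∪ [m]} is given by
-- its ∅-coordinate z0 and the function z on [m].

InK : (n t : ℕ) → ℚ → (Elem n → ℚ) → Set
InK n t z0 z =
    (0ℚ ℚ.≤ z0)
  × (∀ i j (p : i < j) → 0ℚ ℚ.≤ (z (vtx i) + z (vtx j)) - z (edg i j p))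
  × (((+ t) / 1) * z0 ℚ.≤ sumℚ (map z (edges n)))
  × (∀ q → 0ℚ ℚ.≤ z q)
  × (∀ q → - z0 ℚ.≤ - z q)

-- The column  Y (Σ_{T⊆N} (-1)^{|T|} e_{Y∪T})  of the moment matrix of y,
-- evaluated at row A ∈ P_1 (A = ∅ or A = {q}).
colVec : ∀ {n} → (List (Elem n) → ℚ) → List (Elem n) → List (Elem n)
       → List (Elem n) → ℚ
colVec y Y N A = sumℚ (map (λ T → signℚ (length T) * y (A ++ Y ++ T)) (subsets N))

-- y witnesses that (y_A)_{A∈P_1} ∈ S^(r)(P_t(K_n)):
-- x_∅ = y_∅ = 1 and all the Sherali–Adams columns lie in K.
-- (Y e_∅ = (y_A)_{A∈P_1} holds by construction.)
SAWitness : (n r t : ℕ) → (List (Elem n) → ℚ) → Set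
SAWitness n r t y =
    (y [] ≡ 1ℚ)
  × (∀ (Y N : List (Elem n)) → Unique Y → Unique N → card∪ Y N ≤ r →
       InK n t (colVec y Y N []) (λ q → colVec y Y N (q ∷ [])))
  where open import Data.List.Relation.Unary.Unique.Propositional using (Unique)

-- Write w = x_Y ∏_{q ∈ N} (1 - x_q). Inclusion–exclusion turns the Sherali–Adams
-- column of (Y, N) into the moment vector z_A = E[x_A w] of this nonnegative weight
-- under D_p. As x_q ∈ {0, 1} and x_{ij} = x_i ∨ x_j pointwise, every constraint of
-- P_t except Σ_e x_e ≥ t holds for z. For that one: w does not depend on the at
-- least m = n - 2r vertices untouched by Y ∪ N, so independence gives z_i = p z_∅
-- for each such i, and every edge ij with i < j has z_{ij} ≥ z_i. There are at least
-- C(m,2) such edges, whence Σ_e z_e ≥ C(m,2) p z_∅ = t z_∅. The bound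
-- n ≥ 2r + 2t + 2 ensures C(m,2) ≥ t, i.e. p ≤ 1.
module Submission where

open import Defs

open import Algebra.Bundles using (module Ring)
open import Data.Bool using (Bool; true; false; _∧_; _∨_; if_then_else_)
open import Data.Bool.Properties using (∧-assoc; ∧-identityʳ)
open import Data.Fin as Fin using (Fin; zero; suc; _<?_)
open import Data.Fin.Subset using (Subset; inside; outside; ⁅_⁆; _∪_; ⋃; ∁; ∣_∣; _∈_; _∉_)
open import Data.Fin.Subset.Properties
  using (∣⁅x⁆∣≡1; x∉⁅y⁆⇒x≢y; x∈p∪q⁺; ∣p∣≤∣x∷p∣; ∣⊥∣≡0; ∣p∣≤n; x∈∁p⇒x∉p; ∣∁p∣≡n∸∣p∣)
import Data.Integer as ℤ
import Data.Integer.Properties as ℤ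
open import Data.List using (List; []; _∷_; _++_; map; foldr; length; concatMap; mapMaybe; allFin; tabulate; deduplicate)
open import Data.List.Properties using (map-++; map-cong; map-∘; map-cong-local)
open import Data.List.Membership.Propositional.Properties using (∈-deduplicate⁺)
open import Data.List.Relation.Unary.All as All using (All; []; _∷_)
open import Data.List.Relation.Unary.All.Properties using (++⁻ˡ; ++⁻ʳ)
open import Data.List.Relation.Unary.Unique.Propositional using (Unique)
open import Data.Maybe using (Maybe; just; nothing; maybe)
open import Data.Nat as ℕ using (ℕ; zero; suc; z≤n; s≤s; _∸_)
import Data.Nat.Properties as ℕ
open import Data.Nat.Combinatorics using (_C_; nCk+nC[k+1]≡[n+1]C[k+1]; nC1≡n)
open import Data.Nat.Tactic.RingSolver using (solve-∀)
open import Data.Product using (Σ-syntax; _,_; proj₁; proj₂)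
open import Data.Rational using (ℚ; 0ℚ; 1ℚ; _+_; _*_; _-_; -_; _/_; _≤_; toℚᵘ; nonNegative)
open import Data.Rational.Properties
  using ( +-identityˡ; +-identityʳ; +-assoc; +-inverseʳ; +-mono-≤; +-monoˡ-≤; +-monoʳ-≤
        ; *-zeroˡ; *-zeroʳ; *-identityˡ; *-assoc; *-distribˡ-+; *-distribʳ-+
        ; *-monoˡ-≤-nonNeg; *-monoʳ-≤-nonNeg; nonNeg*nonNeg⇒nonNeg; nonNegative⁻¹; normalize-nonNeg
        ; ≤-refl; ≤-reflexive; ≤-trans; neg-antimono-≤; module ≤-Reasoning
        ; +-0-monoid; +-*-ring
        ; toℚᵘ-homo-+; toℚᵘ-homo-*; toℚᵘ-injective; toℚᵘ-fromℚᵘ; toℚᵘ-cancel-≤ )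
open import Data.Rational.Solver using (module +-*-Solver)
import Data.Rational.Unnormalised as ℚᵘ
import Data.Rational.Unnormalised.Properties as ℚᵘ
open import Data.Sum using (inj₁; inj₂)
open import Data.Vec using (Vec; []; _∷_; lookup; _[_]≔_)
open import Data.Vec.Properties using (lookup∘update′; lookup⇒[]=)
open import Algebra.Properties.Monoid.Sum +-0-monoid using (sum; sum-cong-≗; sum-replicate; sum-replicate-zero)
open import Algebra.Properties.Monoid.Mult +-0-monoid using (_×_; ×-homo-+)
open import Algebra.Properties.Semiring.Mult (Ring.semiring +-*-ring) using (×-assoc-*)
open import Function using (_∘_; const; id)
open import Relation.Binary.Definitions using (DecidableEquality)
open import Relation.Binary.PropositionalEquality
open import Relation.Nullary using (yes; no)
open import Relation.Nullary.Negation using (contradiction)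

ind : Bool → ℚ
ind b = if b then 1ℚ else 0ℚ

prodℚ : List ℚ → ℚ
prodℚ = foldr _*_ 1ℚ

sumℚ-++ : ∀ xs ys → sumℚ (xs ++ ys) ≡ sumℚ xs + sumℚ ys
sumℚ-++ []       ys = sym (+-identityˡ _)
sumℚ-++ (x ∷ xs) ys = trans (cong (x +_) (sumℚ-++ xs ys)) (sym (+-assoc x _ _))

sumℚ-*ˡ : ∀ {A : Set} c (f : A → ℚ) xs → sumℚ (map (λ x → c * f x) xs) ≡ c * sumℚ (map f xs)
sumℚ-*ˡ c f []       = sym (*-zeroʳ c)
sumℚ-*ˡ c f (x ∷ xs) = trans (cong (c * f x +_) (sumℚ-*ˡ c f xs)) (sym (*-distribˡ-+ c (f x) _))

sumℚ-concatMap : ∀ {A B : Set} (f : B → ℚ) (g : A → List B) xs →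
                 sumℚ (map f (concatMap g xs)) ≡ sumℚ (map (λ x → sumℚ (map f (g x))) xs)
sumℚ-concatMap f g []       = refl
sumℚ-concatMap f g (x ∷ xs) = begin
  sumℚ (map f (g x ++ concatMap g xs))               ≡⟨ cong sumℚ (map-++ f (g x) _) ⟩
  sumℚ (map f (g x) ++ map f (concatMap g xs))       ≡⟨ sumℚ-++ (map f (g x)) _ ⟩
  sumℚ (map f (g x)) + sumℚ (map f (concatMap g xs)) ≡⟨ cong (sumℚ (map f (g x)) +_) (sumℚ-concatMap f g xs) ⟩
  sumℚ (map f (g x)) + sumℚ (map (λ x → sumℚ (map f (g x))) xs) ∎
  where open ≡-Reasoning

sumℚ-mapMaybe : ∀ {A B : Set} (f : B → ℚ) (g : A → Maybe B) xs →
                sumℚ (map f (mapMaybe g xs)) ≡ sumℚ (map (maybe f 0ℚ ∘ g) xs)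
sumℚ-mapMaybe f g []       = refl
sumℚ-mapMaybe f g (x ∷ xs) with g x
... | just y  = cong (f y +_) (sumℚ-mapMaybe f g xs)
... | nothing = trans (sumℚ-mapMaybe f g xs) (sym (+-identityˡ _))

p≤q⇒0≤q-p : ∀ {p q} → p ≤ q → 0ℚ ≤ q - p
p≤q⇒0≤q-p {p} {q} p≤q = subst (_≤ q - p) (+-inverseʳ p) (+-monoˡ-≤ (- p) p≤q)

*-monoˡ-≤-0≤ : ∀ {c a b} → 0ℚ ≤ c → a ≤ b → c * a ≤ c * b
*-monoˡ-≤-0≤ {c} 0≤c = *-monoˡ-≤-nonNeg c {{nonNegative 0≤c}}

*-monoʳ-≤-0≤ : ∀ {c a b} → 0ℚ ≤ c → a ≤ b → a * c ≤ b * c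
*-monoʳ-≤-0≤ {c} 0≤c = *-monoʳ-≤-nonNeg c {{nonNegative 0≤c}}

*-nonNeg : ∀ {a b} → 0ℚ ≤ a → 0ℚ ≤ b → 0ℚ ≤ a * b
*-nonNeg {a} {b} 0≤a 0≤b =
  nonNegative⁻¹ (a * b) {{nonNeg*nonNeg⇒nonNeg a {{nonNegative 0≤a}} b {{nonNegative 0≤b}}}}

0≤ind : ∀ b → 0ℚ ≤ ind b
0≤ind true  = nonNegative⁻¹ 1ℚ
0≤ind false = ≤-refl

ind≤1 : ∀ b → ind b ≤ 1ℚ
ind≤1 true  = ≤-refl
ind≤1 false = nonNegative⁻¹ 1ℚ

ind≤ind-∨ : ∀ a b → ind a ≤ ind (a ∨ b)
ind≤ind-∨ true  b = ≤-refl
ind≤ind-∨ false b = 0≤ind b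

ind-∨≤+ : ∀ a b → ind (a ∨ b) ≤ ind a + ind b
ind-∨≤+ true  true  = +-monoʳ-≤ 1ℚ (nonNegative⁻¹ 1ℚ)
ind-∨≤+ true  false = ≤-reflexive (sym (+-identityʳ 1ℚ))
ind-∨≤+ false b     = ≤-reflexive (sym (+-identityˡ (ind b)))

sum-mono-≤ : ∀ {n} {f g : Fin n → ℚ} → (∀ i → f i ≤ g i) → sum f ≤ sum g
sum-mono-≤ {zero}  f≤g = ≤-refl
sum-mono-≤ {suc n} f≤g = +-mono-≤ (f≤g Fin.zero) (sum-mono-≤ (f≤g ∘ Fin.suc))

×-nonNeg : ∀ n {c} → 0ℚ ≤ c → 0ℚ ≤ n × c
×-nonNeg zero    0≤c = ≤-refl
×-nonNeg (suc n) {c} 0≤c = subst (_≤ c + n × c) (+-identityˡ 0ℚ) (+-mono-≤ 0≤c (×-nonNeg n 0≤c))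

×-monoˡ-≤ : ∀ {m n c} → 0ℚ ≤ c → m ℕ.≤ n → m × c ≤ n × c
×-monoˡ-≤ {n = n} 0≤c z≤n     = ×-nonNeg n 0≤c
×-monoˡ-≤ {c = c} 0≤c (s≤s m≤n) = +-monoʳ-≤ c (×-monoˡ-≤ 0≤c m≤n)

-- Expectation under the product of n Bernoulli(p) bits

module _ (p : ℚ) where

  open +-*-Solver using (solve; _:+_; _:*_; _:-_; :-_; _:=_; con)

  𝔼 : (n : ℕ) → (Vec Bool n → ℚ) → ℚ
  𝔼 zero    f = f []
  𝔼 (suc n) f = p * 𝔼 n (f ∘ (true ∷_)) + (1ℚ - p) * 𝔼 n (f ∘ (false ∷_))

  Pr≡𝔼 : ∀ n f → Pr p n f ≡ 𝔼 n (ind ∘ f)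
  Pr≡𝔼 zero    f = refl
  Pr≡𝔼 (suc n) f = cong₂ (λ a b → p * a + (1ℚ - p) * b) (Pr≡𝔼 n _) (Pr≡𝔼 n _)

  𝔼-cong : ∀ n {f g : Vec Bool n → ℚ} → (∀ S → f S ≡ g S) → 𝔼 n f ≡ 𝔼 n g
  𝔼-cong zero    f≗g = f≗g []
  𝔼-cong (suc n) f≗g = cong₂ (λ a b → p * a + (1ℚ - p) * b)
    (𝔼-cong n (f≗g ∘ (true ∷_))) (𝔼-cong n (f≗g ∘ (false ∷_)))

  𝔼-const : ∀ n c → 𝔼 n (const c) ≡ c
  𝔼-const zero    c = refl
  𝔼-const (suc n) c rewrite 𝔼-const n c =
    solve 2 (λ p c → p :* c :+ (con 1ℚ :- p) :* c := c) refl p c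

  𝔼-+ : ∀ n (f g : Vec Bool n → ℚ) → 𝔼 n (λ S → f S + g S) ≡ 𝔼 n f + 𝔼 n g
  𝔼-+ zero    f g = refl
  𝔼-+ (suc n) f g rewrite 𝔼-+ n (f ∘ (true ∷_)) (g ∘ (true ∷_))
                        | 𝔼-+ n (f ∘ (false ∷_)) (g ∘ (false ∷_)) =
    solve 5 (λ p a b c d → p :* (a :+ b) :+ (con 1ℚ :- p) :* (c :+ d)
                        := (p :* a :+ (con 1ℚ :- p) :* c) :+ (p :* b :+ (con 1ℚ :- p) :* d))
            refl p _ _ _ _

  𝔼-*ˡ : ∀ n c (f : Vec Bool n → ℚ) → 𝔼 n (λ S → c * f S) ≡ c * 𝔼 n f
  𝔼-*ˡ zero    c f = refl
  𝔼-*ˡ (suc n) c f rewrite 𝔼-*ˡ n c (f ∘ (true ∷_)) | 𝔼-*ˡ n c (f ∘ (false ∷_)) =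
    solve 4 (λ p c a b → p :* (c :* a) :+ (con 1ℚ :- p) :* (c :* b) := c :* (p :* a :+ (con 1ℚ :- p) :* b))
            refl p c _ _

  𝔼-sumℚ : ∀ {A : Set} n (f : A → Vec Bool n → ℚ) xs →
           sumℚ (map (λ x → 𝔼 n (f x)) xs) ≡ 𝔼 n (λ S → sumℚ (map (λ x → f x S) xs))
  𝔼-sumℚ n f []       = sym (𝔼-const n 0ℚ)
  𝔼-sumℚ n f (x ∷ xs) = trans (cong (𝔼 n (f x) +_) (𝔼-sumℚ n f xs)) (sym (𝔼-+ n (f x) _))

  𝔼-independent : ∀ n k (f : Vec Bool n → ℚ) → (∀ S b → f (S [ k ]≔ b) ≡ f S) →
                  𝔼 n (λ S → ind (lookup S k) * f S) ≡ p * 𝔼 n f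
  𝔼-independent (suc n) Fin.zero f f-ignores-k = begin
    p * 𝔼 n (λ S → 1ℚ * f (true ∷ S)) + (1ℚ - p) * 𝔼 n (λ S → 0ℚ * f (false ∷ S))
      ≡⟨ cong₂ (λ a b → p * a + (1ℚ - p) * b) (𝔼-cong n (λ S → *-identityˡ (f (true ∷ S))))
                                             (trans (𝔼-cong n (λ S → *-zeroˡ (f (false ∷ S)))) (𝔼-const n 0ℚ)) ⟩
    p * A + (1ℚ - p) * 0ℚ
      ≡⟨ solve 2 (λ p a → p :* a :+ (con 1ℚ :- p) :* con 0ℚ := p :* (p :* a :+ (con 1ℚ :- p) :* a)) refl p A ⟩
    p * (p * A + (1ℚ - p) * A)
      ≡⟨ cong (λ b → p * (p * A + (1ℚ - p) * b)) (𝔼-cong n (λ S → sym (f-ignores-k (true ∷ S) false))) ⟩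
    p * (p * A + (1ℚ - p) * 𝔼 n (f ∘ (false ∷_))) ∎
    where
    open ≡-Reasoning
    A : ℚ
    A = 𝔼 n (f ∘ (true ∷_))
  𝔼-independent (suc n) (Fin.suc k) f f-ignores-k
    rewrite 𝔼-independent n k (f ∘ (true ∷_)) (f-ignores-k ∘ (true ∷_))
          | 𝔼-independent n k (f ∘ (false ∷_)) (f-ignores-k ∘ (false ∷_)) =
    solve 3 (λ p a b → p :* (p :* a) :+ (con 1ℚ :- p) :* (p :* b) := p :* (p :* a :+ (con 1ℚ :- p) :* b)) refl p _ _

  module _ (0≤p : 0ℚ ≤ p) (p≤1 : p ≤ 1ℚ) where

    𝔼-mono-≤ : ∀ n {f g : Vec Bool n → ℚ} → (∀ S → f S ≤ g S) → 𝔼 n f ≤ 𝔼 n g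
    𝔼-mono-≤ zero    f≤g = f≤g []
    𝔼-mono-≤ (suc n) f≤g = +-mono-≤ (*-monoˡ-≤-0≤ 0≤p (𝔼-mono-≤ n (f≤g ∘ (true ∷_))))
                                    (*-monoˡ-≤-0≤ (p≤q⇒0≤q-p p≤1) (𝔼-mono-≤ n (f≤g ∘ (false ∷_))))

    𝔼-nonNeg : ∀ n {f : Vec Bool n → ℚ} → (∀ S → 0ℚ ≤ f S) → 0ℚ ≤ 𝔼 n f
    𝔼-nonNeg n {f} 0≤f = subst (_≤ 𝔼 n f) (𝔼-const n 0ℚ) (𝔼-mono-≤ n 0≤f)

-- Inclusion–exclusion

ind-∧ : ∀ a b → ind (a ∧ b) ≡ ind a * ind b
ind-∧ true  b = sym (*-identityˡ (ind b))
ind-∧ false b = sym (*-zeroˡ (ind b))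

sumℚ-subsets-alternating : ∀ {A : Set} (a : A → ℚ) N →
  sumℚ (map (λ T → signℚ (length T) * prodℚ (map a T)) (subsets N)) ≡ prodℚ (map (λ q → 1ℚ - a q) N)
sumℚ-subsets-alternating a []      = *-identityˡ 1ℚ
sumℚ-subsets-alternating {A} a (x ∷ N) = begin
  sumℚ (map term (subsets N ++ map (x ∷_) (subsets N)))
    ≡⟨ cong sumℚ (map-++ term (subsets N) _) ⟩
  sumℚ (map term (subsets N) ++ map term (map (x ∷_) (subsets N)))
    ≡⟨ sumℚ-++ (map term (subsets N)) _ ⟩
  P + sumℚ (map term (map (x ∷_) (subsets N)))
    ≡⟨ cong (λ xs → P + sumℚ xs) (sym (map-∘ (subsets N))) ⟩
  P + sumℚ (map (term ∘ (x ∷_)) (subsets N))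
    ≡⟨ cong (λ xs → P + sumℚ xs) (map-cong term-∷ (subsets N)) ⟩
  P + sumℚ (map (λ T → (- a x) * term T) (subsets N))
    ≡⟨ cong (P +_) (sumℚ-*ˡ (- a x) term (subsets N)) ⟩
  P + (- a x) * P
    ≡⟨ solve 2 (λ P a → P :+ (:- a) :* P := (con 1ℚ :- a) :* P) refl P (a x) ⟩
  (1ℚ - a x) * P
    ≡⟨ cong ((1ℚ - a x) *_) (sumℚ-subsets-alternating a N) ⟩
  (1ℚ - a x) * prodℚ (map (λ q → 1ℚ - a q) N) ∎
  where
  open ≡-Reasoning
  open +-*-Solver using (solve; _:+_; _:*_; _:-_; :-_; _:=_; con)
  term : List A → ℚ
  term T = signℚ (length T) * prodℚ (map a T)
  P : ℚ
  P = sumℚ (map term (subsets N))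
  term-∷ : ∀ T → term (x ∷ T) ≡ (- a x) * term T
  term-∷ T = solve 3 (λ s a b → (:- s) :* (a :* b) := (:- a) :* (s :* b)) refl (signℚ (length T)) (a x) _

allOne-++ : ∀ {n} (S : Vec Bool n) A B → allOne S (A ++ B) ≡ allOne S A ∧ allOne S B
allOne-++ S []      B = refl
allOne-++ S (q ∷ A) B = trans (cong (xval S q ∧_) (allOne-++ S A B)) (sym (∧-assoc (xval S q) _ _))

ind-allOne : ∀ {n} (S : Vec Bool n) A → ind (allOne S A) ≡ prodℚ (map (ind ∘ xval S) A)
ind-allOne S []      = refl
ind-allOne S (q ∷ A) = trans (ind-∧ (xval S q) (allOne S A)) (cong (ind (xval S q) *_) (ind-allOne S A))

weight : ∀ {n} → List (Elem n) → List (Elem n) → Vec Bool n → ℚ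
weight Y N S = ind (allOne S Y) * prodℚ (map (λ q → 1ℚ - ind (xval S q)) N)

colVec≡𝔼-weight : ∀ p n (Y N A : List (Elem n)) →
  colVec (λ B → Pr p n (λ S → allOne S B)) Y N A ≡ 𝔼 p n (λ S → ind (allOne S A) * weight Y N S)
colVec≡𝔼-weight p n Y N A = begin
  sumℚ (map (λ T → signℚ (length T) * Pr p n (λ S → allOne S (A ++ Y ++ T))) (subsets N))
    ≡⟨ cong sumℚ (map-cong term-𝔼 (subsets N)) ⟩
  sumℚ (map (λ T → 𝔼 p n (term T)) (subsets N))
    ≡⟨ 𝔼-sumℚ p n term (subsets N) ⟩
  𝔼 p n (λ S → sumℚ (map (λ T → term T S) (subsets N)))
    ≡⟨ 𝔼-cong p n sum-terms ⟩
  𝔼 p n (λ S → ind (allOne S A) * weight Y N S) ∎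
  where
  open ≡-Reasoning
  open +-*-Solver using (solve; _:*_; _:=_)
  term : List (Elem n) → Vec Bool n → ℚ
  term T S = signℚ (length T) * ind (allOne S (A ++ Y ++ T))
  term-𝔼 : ∀ T → signℚ (length T) * Pr p n (λ S → allOne S (A ++ Y ++ T)) ≡ 𝔼 p n (term T)
  term-𝔼 T = trans (cong (signℚ (length T) *_) (Pr≡𝔼 p n _)) (sym (𝔼-*ˡ p n (signℚ (length T)) _))
  term-split : ∀ S T → term T S ≡
               (ind (allOne S A) * ind (allOne S Y)) * (signℚ (length T) * prodℚ (map (ind ∘ xval S) T))
  term-split S T rewrite allOne-++ S A (Y ++ T) | allOne-++ S Y T
                       | ind-∧ (allOne S A) (allOne S Y ∧ allOne S T) | ind-∧ (allOne S Y) (allOne S T)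
                       | ind-allOne S T =
    solve 4 (λ s a b c → s :* (a :* (b :* c)) := (a :* b) :* (s :* c)) refl
            (signℚ (length T)) (ind (allOne S A)) (ind (allOne S Y)) (prodℚ (map (ind ∘ xval S) T))
  sum-terms : ∀ S → sumℚ (map (λ T → term T S) (subsets N)) ≡ ind (allOne S A) * weight Y N S
  sum-terms S = begin
    sumℚ (map (λ T → term T S) (subsets N))
      ≡⟨ cong sumℚ (map-cong (term-split S) (subsets N)) ⟩
    sumℚ (map (λ T → c * (signℚ (length T) * prodℚ (map (ind ∘ xval S) T))) (subsets N))
      ≡⟨ sumℚ-*ˡ c _ (subsets N) ⟩
    c * sumℚ (map (λ T → signℚ (length T) * prodℚ (map (ind ∘ xval S) T)) (subsets N))
      ≡⟨ cong (c *_) (sumℚ-subsets-alternating (ind ∘ xval S) N) ⟩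
    c * prodℚ (map (λ q → 1ℚ - ind (xval S q)) N)
      ≡⟨ *-assoc (ind (allOne S A)) (ind (allOne S Y)) _ ⟩
    ind (allOne S A) * weight Y N S ∎
    where
    c : ℚ
    c = ind (allOne S A) * ind (allOne S Y)

colVec-[] : ∀ p n (Y N : List (Elem n)) → colVec (λ B → Pr p n (λ S → allOne S B)) Y N [] ≡ 𝔼 p n (weight Y N)
colVec-[] p n Y N = trans (colVec≡𝔼-weight p n Y N []) (𝔼-cong p n (λ S → *-identityˡ (weight Y N S)))

colVec-[q] : ∀ p n (Y N : List (Elem n)) q →
  colVec (λ B → Pr p n (λ S → allOne S B)) Y N (q ∷ []) ≡ 𝔼 p n (λ S → ind (xval S q) * weight Y N S)
colVec-[q] p n Y N q = trans (colVec≡𝔼-weight p n Y N (q ∷ []))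
  (𝔼-cong p n (λ S → cong (λ b → ind b * weight Y N S) (∧-identityʳ (xval S q))))

0≤weight : ∀ {n} (Y N : List (Elem n)) S → 0ℚ ≤ weight Y N S
0≤weight Y N S = *-nonNeg (0≤ind (allOne S Y)) (0≤prod N)
  where
  0≤prod : ∀ N → 0ℚ ≤ prodℚ (map (λ q → 1ℚ - ind (xval S q)) N)
  0≤prod []      = nonNegative⁻¹ 1ℚ
  0≤prod (q ∷ N) = *-nonNeg (p≤q⇒0≤q-p (ind≤1 (xval S q))) (0≤prod N)

-- Vertices touched by Y ∪ N

support : ∀ {n} → Elem n → Subset n
support (vtx i)     = ⁅ i ⁆
support (edg i j _) = ⁅ i ⁆ ∪ ⁅ j ⁆

touched : ∀ {n} → List (Elem n) → Subset n
touched = ⋃ ∘ map support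

∣p∪q∣≤∣p∣+∣q∣ : ∀ {n} (p q : Subset n) → ∣ p ∪ q ∣ ℕ.≤ ∣ p ∣ ℕ.+ ∣ q ∣
∣p∪q∣≤∣p∣+∣q∣ []            []            = z≤n
∣p∪q∣≤∣p∣+∣q∣ (inside ∷ p)  (x ∷ q)       =
  s≤s (ℕ.≤-trans (∣p∪q∣≤∣p∣+∣q∣ p q) (ℕ.+-monoʳ-≤ ∣ p ∣ (∣p∣≤∣x∷p∣ x q)))
∣p∪q∣≤∣p∣+∣q∣ (outside ∷ p) (inside ∷ q)  =
  ℕ.≤-trans (s≤s (∣p∪q∣≤∣p∣+∣q∣ p q)) (ℕ.≤-reflexive (sym (ℕ.+-suc ∣ p ∣ ∣ q ∣)))
∣p∪q∣≤∣p∣+∣q∣ (outside ∷ p) (outside ∷ q) = ∣p∪q∣≤∣p∣+∣q∣ p q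

∣support∣≤2 : ∀ {n} (q : Elem n) → ∣ support q ∣ ℕ.≤ 2
∣support∣≤2 (vtx i)     = ℕ.≤-trans (ℕ.≤-reflexive (∣⁅x⁆∣≡1 i)) (s≤s z≤n)
∣support∣≤2 (edg i j _) = ℕ.≤-trans (∣p∪q∣≤∣p∣+∣q∣ ⁅ i ⁆ ⁅ j ⁆)
                                    (ℕ.≤-reflexive (cong₂ ℕ._+_ (∣⁅x⁆∣≡1 i) (∣⁅x⁆∣≡1 j)))

∣touched∣≤2*length : ∀ {n} (L : List (Elem n)) → ∣ touched L ∣ ℕ.≤ 2 ℕ.* length L
∣touched∣≤2*length {n} []      = ℕ.≤-reflexive (∣⊥∣≡0 n)
∣touched∣≤2*length     (q ∷ L) = begin
  ∣ support q ∪ touched L ∣          ≤⟨ ∣p∪q∣≤∣p∣+∣q∣ (support q) (touched L) ⟩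
  ∣ support q ∣ ℕ.+ ∣ touched L ∣    ≤⟨ ℕ.+-mono-≤ (∣support∣≤2 q) (∣touched∣≤2*length L) ⟩
  2 ℕ.+ 2 ℕ.* length L              ≡⟨ ℕ.*-suc 2 (length L) ⟨
  2 ℕ.* suc (length L)              ∎
  where open ℕ.≤-Reasoning

∉touched⇒∉support : ∀ {n} {k : Fin n} L → k ∉ touched L → All (λ q → k ∉ support q) L
∉touched⇒∉support []      k∉ = []
∉touched⇒∉support (q ∷ L) k∉ =
  (k∉ ∘ x∈p∪q⁺ ∘ inj₁) ∷ ∉touched⇒∉support L (k∉ ∘ x∈p∪q⁺ ∘ inj₂)

xval-update : ∀ {n} {k : Fin n} q → k ∉ support q → ∀ S b → xval (S [ k ]≔ b) q ≡ xval S q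
xval-update (vtx i)     k∉ S b = lookup∘update′ (≢-sym (x∉⁅y⁆⇒x≢y k∉)) S b
xval-update (edg i j _) k∉ S b = cong₂ _∨_
  (lookup∘update′ (≢-sym (x∉⁅y⁆⇒x≢y (k∉ ∘ x∈p∪q⁺ ∘ inj₁))) S b)
  (lookup∘update′ (≢-sym (x∉⁅y⁆⇒x≢y (k∉ ∘ x∈p∪q⁺ ∘ inj₂))) S b)

allOne-cong : ∀ {n} {S S′ : Vec Bool n} {A} → All (λ q → xval S q ≡ xval S′ q) A → allOne S A ≡ allOne S′ A
allOne-cong []         = refl
allOne-cong (eq ∷ eqs) = cong₂ _∧_ eq (allOne-cong eqs)

All-deduplicate⁻ : ∀ {A : Set} {P : A → Set} (_≟_ : DecidableEquality A) xs →
                   All P (deduplicate _≟_ xs) → All P xs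
All-deduplicate⁻ _≟_ xs h = All.tabulate (All.lookup h ∘ ∈-deduplicate⁺ _≟_)

untouched : ∀ {n} → List (Elem n) → List (Elem n) → Subset n
untouched Y N = ∁ (touched (deduplicate _≟E_ (Y ++ N)))

n∸2r≤∣untouched∣ : ∀ {n r} (Y N : List (Elem n)) → card∪ Y N ℕ.≤ r →
                   n ∸ 2 ℕ.* r ℕ.≤ ∣ untouched Y N ∣
n∸2r≤∣untouched∣ {n} {r} Y N card≤r = begin
  n ∸ 2 ℕ.* r       ≤⟨ ℕ.∸-monoʳ-≤ n (ℕ.≤-trans (∣touched∣≤2*length L) (ℕ.*-monoʳ-≤ 2 card≤r)) ⟩
  n ∸ ∣ touched L ∣ ≡⟨ ∣∁p∣≡n∸∣p∣ (touched L) ⟨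
  ∣ untouched Y N ∣ ∎
  where
  open ℕ.≤-Reasoning
  L : List (Elem n)
  L = deduplicate _≟E_ (Y ++ N)

weight-update : ∀ {n} (Y N : List (Elem n)) {k} → k ∈ untouched Y N →
                ∀ S b → weight Y N (S [ k ]≔ b) ≡ weight Y N S
weight-update Y N {k} k∈U S b = cong₂ _*_
  (cong ind (allOne-cong (xval-fixed (++⁻ˡ Y k∉YN))))
  (cong prodℚ (map-cong-local (All.map (cong (λ b → 1ℚ - ind b)) (xval-fixed (++⁻ʳ Y k∉YN)))))
  where
  k∉YN : All (λ q → k ∉ support q) (Y ++ N)
  k∉YN = All-deduplicate⁻ _≟E_ (Y ++ N) (∉touched⇒∉support _ (x∈∁p⇒x∉p k∈U))
  xval-fixed : ∀ {A} → All (λ q → k ∉ support q) A → All (λ q → xval (S [ k ]≔ b) q ≡ xval S q) A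
  xval-fixed = All.map (λ {q} k∉q → xval-update q k∉q S b)

-- Sums over the edges of K_n

edgeValue : ∀ {n} → (Elem n → ℚ) → Fin n → Fin n → ℚ
edgeValue F i j with i <? j
... | yes i<j = F (edg i j i<j)
... | no _    = 0ℚ

-- The selector used by Defs.edges is local to its where-block; unification
-- recovers it, and with-abstraction then sees through it.
private
  edgesView : ∀ n → Σ[ select ∈ (Fin n → Fin n → Maybe (Elem n)) ]
                      edges n ≡ concatMap (λ i → mapMaybe (select i) (allFin n)) (allFin n)
  edgesView n = _ , refl

  select-edgeValue : ∀ {n} (F : Elem n → ℚ) i j → maybe F 0ℚ (proj₁ (edgesView n) i j) ≡ edgeValue F i j
  select-edgeValue F i j with i <? j
  ... | yes _ = refl
  ... | no _  = refl

sumℚ-tabulate : ∀ {A : Set} n (f : A → ℚ) (g : Fin n → A) → sumℚ (map f (tabulate g)) ≡ sum (f ∘ g)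
sumℚ-tabulate zero    f g = refl
sumℚ-tabulate (suc n) f g = cong (f (g Fin.zero) +_) (sumℚ-tabulate n f (g ∘ Fin.suc))

sumℚ-edges : ∀ n (F : Elem n → ℚ) → sumℚ (map F (edges n)) ≡ sum (λ i → sum (edgeValue F i))
sumℚ-edges n F = begin
  sumℚ (map F (edges n))
    ≡⟨ cong (sumℚ ∘ map F) (proj₂ (edgesView n)) ⟩
  sumℚ (map F (concatMap (λ i → mapMaybe (select i) (allFin n)) (allFin n)))
    ≡⟨ sumℚ-concatMap F _ (allFin n) ⟩
  sumℚ (map (λ i → sumℚ (map F (mapMaybe (select i) (allFin n)))) (allFin n))
    ≡⟨ cong sumℚ (map-cong row (allFin n)) ⟩
  sumℚ (map (λ i → sum (edgeValue F i)) (allFin n))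
    ≡⟨ sumℚ-tabulate n _ id ⟩
  sum (λ i → sum (edgeValue F i)) ∎
  where
  open ≡-Reasoning
  select : Fin n → Fin n → Maybe (Elem n)
  select = proj₁ (edgesView n)
  row : ∀ i → sumℚ (map F (mapMaybe (select i) (allFin n))) ≡ sum (edgeValue F i)
  row i = begin
    sumℚ (map F (mapMaybe (select i) (allFin n)))     ≡⟨ sumℚ-mapMaybe F (select i) (allFin n) ⟩
    sumℚ (map (maybe F 0ℚ ∘ select i) (allFin n))     ≡⟨ cong sumℚ (map-cong (select-edgeValue F i) (allFin n)) ⟩
    sumℚ (map (edgeValue F i) (allFin n))             ≡⟨ sumℚ-tabulate n (edgeValue F i) id ⟩
    sum (edgeValue F i)                               ∎

pairCount : ∀ {n} → Subset n → ℕ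
pairCount []                    = 0
pairCount {suc n} (inside ∷ U)  = n ℕ.+ pairCount U
pairCount         (outside ∷ U) = pairCount U

-- Split on i <? j exactly like edgeValue, so that in moments-InK a single
-- with-abstraction unfolds both; the price is pairIndicator-suc.
pairIndicator : ∀ {n} → Subset n → ℚ → Fin n → Fin n → ℚ
pairIndicator U c i j with i <? j
... | yes _ = if lookup U i then c else 0ℚ
... | no _  = 0ℚ

pairIndicator-suc : ∀ {n} b (U : Subset n) c i j → pairIndicator (b ∷ U) c (suc i) (suc j) ≡ pairIndicator U c i j
pairIndicator-suc b U c i j with suc i <? suc j | i <? j
... | yes _     | yes _   = refl
... | no _      | no _    = refl
... | yes si<sj | no i≮j  = contradiction (ℕ.s<s⁻¹ si<sj) i≮j
... | no si≮sj  | yes i<j = contradiction (ℕ.s<s i<j) si≮sj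

sum-pairIndicator : ∀ {n} (U : Subset n) c → sum (λ i → sum (pairIndicator U c i)) ≡ pairCount U × c
sum-pairIndicator []                c = refl
sum-pairIndicator {suc n} (b ∷ U) c = begin
  (0ℚ + sum {n} (const x)) + sum (λ i → sum (pairIndicator (b ∷ U) c (suc i)))
    ≡⟨ cong₂ _+_ (+-identityˡ (sum {n} (const x))) (sum-cong-≗ row-suc) ⟩
  sum {n} (const x) + sum (λ i → sum (pairIndicator U c i))
    ≡⟨ cong (sum {n} (const x) +_) (sum-pairIndicator U c) ⟩
  sum {n} (const x) + pairCount U × c
    ≡⟨ first-row b ⟩
  pairCount (b ∷ U) × c ∎
  where
  open ≡-Reasoning
  x : ℚ
  x = if b then c else 0ℚ
  row-suc : ∀ i → sum (pairIndicator (b ∷ U) c (suc i)) ≡ sum (pairIndicator U c i)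
  row-suc i = trans (+-identityˡ _) (sum-cong-≗ (pairIndicator-suc b U c i))
  first-row : ∀ b′ → sum {n} (const (if b′ then c else 0ℚ)) + pairCount U × c ≡ pairCount (b′ ∷ U) × c
  first-row inside  = trans (cong (_+ pairCount U × c) (sum-replicate n)) (sym (×-homo-+ c n (pairCount U)))
  first-row outside = trans (cong (_+ pairCount U × c) (sum-replicate-zero n)) (+-identityˡ _)

[1+n]C2≡n+nC2 : ∀ n → suc n C 2 ≡ n ℕ.+ n C 2
[1+n]C2≡n+nC2 n = trans (sym (nCk+nC[k+1]≡[n+1]C[k+1] n 1)) (cong (ℕ._+ n C 2) (nC1≡n n))

<⇒≤C2 : ∀ {t m} → t ℕ.< m → t ℕ.≤ m C 2
<⇒≤C2 {m = suc m} (s≤s t≤m) =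
  ℕ.≤-trans t≤m (ℕ.≤-trans (ℕ.m≤m+n m (m C 2)) (ℕ.≤-reflexive (sym ([1+n]C2≡n+nC2 m))))

C2≤pairCount : ∀ {n} m (U : Subset n) → m ℕ.≤ ∣ U ∣ → m C 2 ℕ.≤ pairCount U
C2≤pairCount zero    U             _         = z≤n
C2≤pairCount (suc m) (outside ∷ U) m≤∣U∣     = C2≤pairCount (suc m) U m≤∣U∣
C2≤pairCount (suc m) (inside ∷ U)  (s≤s m≤∣U∣) = begin
  suc m C 2          ≡⟨ [1+n]C2≡n+nC2 m ⟩
  m ℕ.+ m C 2        ≤⟨ ℕ.+-mono-≤ (ℕ.≤-trans m≤∣U∣ (∣p∣≤n U)) (C2≤pairCount m U m≤∣U∣) ⟩
  _ ℕ.+ pairCount U  ∎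
  where open ℕ.≤-Reasoning

toℚᵘ-×1 : ∀ k → toℚᵘ (k × 1ℚ) ℚᵘ.≃ ℚᵘ.mkℚᵘ (ℤ.+ k) 0
toℚᵘ-×1 zero    = ℚᵘ.≃-refl
toℚᵘ-×1 (suc k) = ℚᵘ.≃-trans (toℚᵘ-homo-+ 1ℚ (k × 1ℚ))
  (ℚᵘ.≃-trans (ℚᵘ.+-congʳ (toℚᵘ 1ℚ) (toℚᵘ-×1 k))
              (ℚᵘ.*≡* (cong (λ a → (ℤ.+ 1 ℤ.+ a) ℤ.* ℤ.+ 1) (ℤ.*-identityʳ (ℤ.+ k)))))

0≤divℚ : ∀ t C → 0ℚ ≤ divℚ t C
0≤divℚ t zero    = ≤-refl
0≤divℚ t (suc c) = nonNegative⁻¹ (ℤ.+ t / suc c) {{normalize-nonNeg t (suc c)}}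

divℚ≤1 : ∀ {t C} → t ℕ.≤ C → divℚ t C ≤ 1ℚ
divℚ≤1 {C = zero}  _   = nonNegative⁻¹ 1ℚ
divℚ≤1 {t} {suc c} t≤C =
  toℚᵘ-cancel-≤ (ℚᵘ.≤-respˡ-≃ (ℚᵘ.≃-sym (toℚᵘ-fromℚᵘ (ℚᵘ.mkℚᵘ (ℤ.+ t) c)))
  (ℚᵘ.*≤* (subst₂ ℤ._≤_ (sym (ℤ.*-identityʳ (ℤ.+ t))) (sym (ℤ.*-identityˡ (ℤ.+ suc c))) (ℤ.+≤+ t≤C))))

×-divℚ : ∀ t {C} → 1 ℕ.≤ C → C × divℚ t C ≡ ℤ.+ t / 1
×-divℚ t {suc c} _ = begin
  suc c × x          ≡⟨ cong (suc c ×_) (*-identityˡ x) ⟨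
  suc c × (1ℚ * x)   ≡⟨ ×-assoc-* (suc c) 1ℚ x ⟨
  (suc c × 1ℚ) * x   ≡⟨ toℚᵘ-injective toℚᵘ-eq ⟩
  ℤ.+ t / 1            ∎
  where
  open ≡-Reasoning
  x : ℚ
  x = ℤ.+ t / suc c
  toℚᵘ-eq : toℚᵘ ((suc c × 1ℚ) * x) ℚᵘ.≃ toℚᵘ (ℤ.+ t / 1)
  toℚᵘ-eq = ℚᵘ.≃-trans (toℚᵘ-homo-* (suc c × 1ℚ) x)
    (ℚᵘ.≃-trans (ℚᵘ.*-cong (toℚᵘ-×1 (suc c)) (toℚᵘ-fromℚᵘ (ℚᵘ.mkℚᵘ (ℤ.+ t) c)))
    (ℚᵘ.≃-trans (ℚᵘ.*≡* (trans (ℤ.*-identityʳ _) (trans (ℤ.*-comm (ℤ.+ suc c) (ℤ.+ t))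
                                 (cong (ℤ.+ t ℤ.*_) (sym (ℤ.*-identityˡ (ℤ.+ suc c)))))))
    (ℚᵘ.≃-sym (toℚᵘ-fromℚᵘ (ℚᵘ.mkℚᵘ (ℤ.+ t) 0)))))

-- Moment vectors in the homogenization K

InK-cong : ∀ {n t z0 z0′} {z z′ : Elem n → ℚ} → z0 ≡ z0′ → (∀ q → z q ≡ z′ q) →
           InK n t z0 z → InK n t z0′ z′
InK-cong {n} refl z≗z′ (0≤z0 , edge , total , 0≤z , z≤z0) =
  0≤z0 ,
  (λ i j i<j → subst (0ℚ ≤_) (cong₂ _-_ (cong₂ _+_ (z≗z′ _) (z≗z′ _)) (z≗z′ _)) (edge i j i<j)) ,
  subst (_ ≤_) (cong sumℚ (map-cong z≗z′ (edges n))) total ,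
  (λ q → subst (0ℚ ≤_) (z≗z′ q) (0≤z q)) ,
  (λ q → subst (λ a → _ ≤ - a) (z≗z′ q) (z≤z0 q))

module _ {n : ℕ} {p : ℚ} (0≤p : 0ℚ ≤ p) (p≤1 : p ≤ 1ℚ)
         (w : Vec Bool n → ℚ) (0≤w : ∀ S → 0ℚ ≤ w S) where

  private
    z∅ : ℚ
    z∅ = 𝔼 p n w

    z : Elem n → ℚ
    z q = 𝔼 p n (λ S → ind (xval S q) * w S)

    0≤z∅ : 0ℚ ≤ z∅
    0≤z∅ = 𝔼-nonNeg p 0≤p p≤1 n 0≤w

    0≤z : ∀ q → 0ℚ ≤ z q
    0≤z q = 𝔼-nonNeg p 0≤p p≤1 n (λ S → *-nonNeg (0≤ind (xval S q)) (0≤w S))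

    z≤z∅ : ∀ q → z q ≤ z∅
    z≤z∅ q = 𝔼-mono-≤ p 0≤p p≤1 n λ S →
      subst (ind (xval S q) * w S ≤_) (*-identityˡ (w S)) (*-monoʳ-≤-0≤ (0≤w S) (ind≤1 (xval S q)))

    z-edge≤ : ∀ i j i<j → z (edg i j i<j) ≤ z (vtx i) + z (vtx j)
    z-edge≤ i j i<j = subst (z (edg i j i<j) ≤_) (𝔼-+ p n _ _) (𝔼-mono-≤ p 0≤p p≤1 n λ S →
      subst (ind (lookup S i ∨ lookup S j) * w S ≤_) (*-distribʳ-+ (w S) (ind (lookup S i)) (ind (lookup S j)))
                   (*-monoʳ-≤-0≤ (0≤w S) (ind-∨≤+ (lookup S i) (lookup S j))))

    z-vertex≤z-edge : ∀ i j i<j → z (vtx i) ≤ z (edg i j i<j)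
    z-vertex≤z-edge i j i<j = 𝔼-mono-≤ p 0≤p p≤1 n λ S →
      *-monoʳ-≤-0≤ (0≤w S) (ind≤ind-∨ (lookup S i) (lookup S j))

  moments-InK : ∀ t (U : Subset n) → (∀ {k} → k ∈ U → ∀ S b → w (S [ k ]≔ b) ≡ w S) →
                ∀ m → m ℕ.≤ ∣ U ∣ → ℤ.+ t / 1 ≤ (m C 2) × p → InK n t z∅ z
  moments-InK t U w-ignores-U m m≤∣U∣ t≤Cp =
    0≤z∅ , (λ i j i<j → p≤q⇒0≤q-p (z-edge≤ i j i<j)) , total , 0≤z , (λ q → neg-antimono-≤ (z≤z∅ q))
    where
    z-vertex : ∀ {k} → k ∈ U → z (vtx k) ≡ p * z∅
    z-vertex {k} k∈U = 𝔼-independent p n k w (w-ignores-U k∈U)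

    pairIndicator≤edgeValue : ∀ i j → pairIndicator U (p * z∅) i j ≤ edgeValue z i j
    pairIndicator≤edgeValue i j with i <? j
    ... | no _    = ≤-refl
    ... | yes i<j with lookup U i in i∈U
    ...   | true  = ≤-trans (≤-reflexive (sym (z-vertex (lookup⇒[]= i U i∈U)))) (z-vertex≤z-edge i j i<j)
    ...   | false = 0≤z (edg i j i<j)

    total : ℤ.+ t / 1 * z∅ ≤ sumℚ (map z (edges n))
    total = begin
      ℤ.+ t / 1 * z∅                                   ≤⟨ *-monoʳ-≤-0≤ 0≤z∅ t≤Cp ⟩
      (m C 2) × p * z∅                               ≡⟨ ×-assoc-* (m C 2) p z∅ ⟩
      (m C 2) × (p * z∅)                             ≤⟨ ×-monoˡ-≤ (*-nonNeg 0≤p 0≤z∅) (C2≤pairCount m U m≤∣U∣) ⟩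
      pairCount U × (p * z∅)                         ≡⟨ sum-pairIndicator U (p * z∅) ⟨
      sum (λ i → sum (pairIndicator U (p * z∅) i))   ≤⟨ sum-mono-≤ (λ i → sum-mono-≤ (pairIndicator≤edgeValue i)) ⟩
      sum (λ i → sum (edgeValue z i))                ≡⟨ sumℚ-edges n z ⟨
      sumℚ (map z (edges n))                         ∎
      where open ≤-Reasoning

1+t≤n∸2r : ∀ {n r t} → 2 ℕ.* r ℕ.+ 2 ℕ.* t ℕ.+ 2 ℕ.≤ n → suc t ℕ.≤ n ∸ 2 ℕ.* r
1+t≤n∸2r {n} {r} {t} n-large = ℕ.m+n≤o⇒m≤o∸n (suc t)
  (ℕ.≤-trans (ℕ.m≤m+n (suc t ℕ.+ 2 ℕ.* r) (t ℕ.+ 1)) (ℕ.≤-trans (ℕ.≤-reflexive (eq r t)) n-large))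
  where
  eq : ∀ r t → suc t ℕ.+ 2 ℕ.* r ℕ.+ (t ℕ.+ 1) ≡ 2 ℕ.* r ℕ.+ 2 ℕ.* t ℕ.+ 2
  eq = solve-∀

lemma2 : (n r t : ℕ) → 1 ℕ.≤ r → 1 ℕ.≤ t → 2 ℕ.* r ℕ.+ 2 ℕ.* t ℕ.+ 2 ℕ.≤ n →
         SAWitness n r t (yvec n r t)
lemma2 n r t _ 1≤t n-large = trans (Pr≡𝔼 p n _) (𝔼-const p n 1ℚ) , column
  where
  m : ℕ
  m = n ∸ 2 ℕ.* r
  p : ℚ
  p = pval n r t
  t≤C : t ℕ.≤ m C 2
  t≤C = <⇒≤C2 (1+t≤n∸2r {n} {r} {t} n-large)
  column : ∀ Y N → Unique Y → Unique N → card∪ Y N ℕ.≤ r →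
           InK n t (colVec (yvec n r t) Y N []) (λ q → colVec (yvec n r t) Y N (q ∷ []))
  column Y N _ _ card≤r = InK-cong {t = t} (sym (colVec-[] p n Y N)) (λ q → sym (colVec-[q] p n Y N q))
    (moments-InK (0≤divℚ t (m C 2)) (divℚ≤1 t≤C) (weight Y N) (0≤weight Y N)
                 t (untouched Y N) (weight-update Y N) m (n∸2r≤∣untouched∣ Y N card≤r)
                 (≤-reflexive (sym (×-divℚ t (ℕ.≤-trans 1≤t t≤C)))))
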